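{- Let $n\geq 2$ and $D_{2n}=\langle a,b\mid a^n=b^2=(ab)^2=e\rangle$. If $S$ is a generating subset of $D_{2n}$ with $e\notin S=S^{ -1}$ and $|S|\geq 4$, then $\dim_M(\mathrm{Cay}(D_{2n},S))\geq 3$.
   Context: For a simple connected graph $\Gamma$, $d(x,y)$ is the shortest-path distance; for an ordered vertex set $W=\{w_1,\dots,w_k\}$, $r(v\mid W)=(d(v,w_1),\dots,d(v,w_k))$; $W$ is resolving if distinct vertices have distinct representations; $\dim_M(\Gamma)$ is the minimum size of a resolving set. For a group $G$ and $S\subseteq G$ with $e\notin S=S^{ -1}$, $\mathrm{Cay}(G,S)$ has vertex set $G$ with $u\sim v$ iff $uv^{ -1}\in S$; it is connected iff $S$ generates $G$. -}

module Defs where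

open import Data.Bool using (Bool; true; false; _xor_)
open import Data.Nat using (ℕ; zero; suc; _+_; _∸_; _<_; NonZero)
open import Data.Nat.DivMod using (_mod_)
open import Data.Fin using (Fin; toℕ)
open import Data.List using (List; []; _∷_; _++_; map; foldr; length; filterᵇ; allFin)
open import Data.List.Relation.Unary.All using (All)
open import Data.List.Relation.Unary.Unique.Propositional using (Unique)
open import Data.List.Membership.Propositional using (_∈_)
open import Data.Product using (Σ; _×_; _,_; ∃)
open import Relation.Nullary using (¬_)
open import Relation.Binary.PropositionalEquality using (_≡_)

-- The dihedral group D_{2n} = ⟨a,b | a^n = b^2 = (ab)^2 = e⟩, concretely:
-- the pair (k , i) stands for a^i b^k  (k = false: rotation a^i, k = true: reflection a^i b).
-- Since b a b = a⁻¹:  a^i b^k · a^j b^l = a^(i ± j) b^(k+l), with − iff k = true.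
module Dihedral (n : ℕ) {{nz : NonZero n}} where

  D : Set
  D = Bool × Fin n

  addF : Fin n → Fin n → Fin n
  addF i j = (toℕ i + toℕ j) mod n

  negF : Fin n → Fin n
  negF i = (n ∸ toℕ i) mod n

  e : D
  e = false , (0 mod n)

  a : D
  a = false , (1 mod n)

  b : D
  b = true , (0 mod n)

  _·_ : D → D → D
  (false , i) · (l , j) = l , addF i j
  (true  , i) · (l , j) = (true xor l) , addF i (negF j)

  inv : D → D
  inv (false , i) = false , negF i
  inv (true  , i) = true , i

  elements : List D
  elements = map (false ,_) (allFin n) ++ map (true ,_) (allFin n)

  Subset : Set
  Subset = D → Bool

  card : Subset → ℕ
  card S = length (filterᵇ S elements)

  prod : List D → D
  prod = foldr _·_ e

  Generates : Subset → Set
  Generates S = ∀ g → Σ (List D) λ ws → All (λ s → S s ≡ true) ws × prod ws ≡ g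

  module Cayley (S : Subset) where

    Adj : D → D → Set
    Adj u v = S (u · inv v) ≡ true

    data Walk : D → D → ℕ → Set where
      here : ∀ {x} → Walk x x 0
      step : ∀ {x y z k} → Adj x y → Walk y z k → Walk x z (suc k)

    Dist : D → D → ℕ → Set
    Dist x y k = Walk x y k × (∀ j → j < k → ¬ Walk x y j)

    Resolving : List D → Set
    Resolving W = ∀ u v → All (λ w → ∃ λ k → Dist u w k × Dist v w k) W → u ≡ v

    MetricDimAtLeast : ℕ → Set
    MetricDimAtLeast m = ∀ (W : List D) → Unique W → Resolving W → m Data.Nat.≤ length W

-- A resolving set must tell apart the neighbours s · w (s ∈ S) of each of its vertices w,
-- and all of these lie at distance 1 from w. Hence no single vertex resolves, and for
-- W = {w₁, w₂} two of the at least four neighbours of w₁ share their distance to w₂: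
-- being adjacent to w₁, each lies at distance d − 1, d or d + 1 from w₂, where d = d(w₁, w₂).

module Submission where

open import Defs
open import Data.Nat using (ℕ; _≤_; NonZero)
open import Data.Bool using (true; false)
open import Relation.Binary.PropositionalEquality using (_≡_)

open import Algebra.Bundles using (AbelianGroup; Group)
open import Algebra.Consequences.Propositional using (comm∧idˡ⇒id; comm∧invʳ⇒inv)
import Algebra.Properties.AbelianGroup as AbelianGroupProperties
import Algebra.Properties.Group as GroupProperties
open import Data.Bool using (T?)
open import Data.Bool.Properties using (T-≡) renaming (_≟_ to _≟ᴮ_)
open import Data.Empty using (⊥-elim)
open import Data.Fin using (Fin; zero; suc; toℕ; fromℕ<; inject≤)
open import Data.Fin.Properties
  using (toℕ-fromℕ<; toℕ-injective; toℕ<n; inject≤-injective; pigeonhole; <⇒≢; 0≢1+n)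
  renaming (_≟_ to _≟ᶠ_)
open import Data.List using (List; []; _∷_; lookup; length; map; allFin)
open import Data.List.Membership.Propositional using (_∈_; lose)
open import Data.List.Membership.Propositional.Properties
  using (∈-lookup; ∈-map⁺; ∈-map⁻; ∈-++⁺ˡ; ∈-++⁺ʳ; ∈-allFin)
open import Data.List.Relation.Unary.All as All using (All; []; _∷_)
open import Data.List.Relation.Unary.All.Properties using (all-filter)
open import Data.List.Relation.Unary.Any using (Any; satisfied; any?)
open import Data.List.Relation.Unary.AllPairs using (_∷_)
open import Data.List.Relation.Unary.Unique.Propositional using (Unique)
open import Data.List.Relation.Unary.Unique.Propositional.Properties
  using (map⁺; ++⁺; allFin⁺; filter⁺)
open import Data.Nat using (zero; suc; _+_; _∸_; _<_; _%_; z≤n; s≤s; >-nonZero⁻¹)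
open import Data.Nat.DivMod using (_mod_; %-distribˡ-+; m%n%n≡m%n; m<n⇒m%n≡m; n%n≡0)
open import Data.Nat.Properties
  using (≤-refl; ≤-trans; ≤-reflexive; ≮⇒≥; <⇒≤; +-comm; +-assoc; suc-injective;
         ∸-monoˡ-≤; ∸-cancelʳ-≡; m+n∸n≡m; m+[n∸m]≡n)
open import Data.Product using (Σ; _×_; _,_; ∃; ∃₂; proj₁; proj₂)
open import Data.Product.Properties using (≡-dec)
open import Function using (_∘_)
open import Function.Bundles using (Equivalence)
open import Function.Definitions using (Injective)
open import Relation.Binary.PropositionalEquality
  using (_≢_; refl; sym; trans; cong; cong₂; subst; isEquivalence; module ≡-Reasoning)
open import Relation.Nullary using (¬_; Dec; yes; no)
open import Relation.Nullary.Decidable using (_×-dec_; map′)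
open import Relation.Unary using (Decidable)

least-witness : ∀ {p} {P : ℕ → Set p} → Decidable P → ∀ {m} → P m →
                ∃ λ k → P k × (∀ j → j < k → ¬ P j)
least-witness P? {zero} p = zero , p , λ _ ()
least-witness P? {suc m} p with P? zero
... | yes p₀ = zero , p₀ , λ _ ()
... | no ¬p₀ with least-witness (P? ∘ suc) p
...   | k , pk , below = suc k , pk , λ where
          zero    _         → ¬p₀
          (suc j) (s≤s j<k) → below j j<k

within-one-pigeonhole : ∀ {m d} → 3 < m → (k : Fin m → ℕ) →
                        (∀ i → d ≤ suc (k i)) → (∀ i → k i ≤ suc d) →
                        ∃₂ λ i j → i ≢ j × k i ≡ k j
within-one-pigeonhole {m} {d} 3<m k lower upper =
  let i , j , i<j , same-offset = pigeonhole 3<m offset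
  in  i , j , <⇒≢ i<j , offset-injective same-offset
  where
  offset-bound : ∀ i → suc (k i) ∸ d < 3
  offset-bound i = s≤s (≤-trans (∸-monoˡ-≤ d (s≤s (upper i))) (≤-reflexive (m+n∸n≡m 2 d)))

  offset : Fin m → Fin 3
  offset i = fromℕ< (offset-bound i)

  offset-injective : ∀ {i j} → offset i ≡ offset j → k i ≡ k j
  offset-injective {i} {j} eq = suc-injective (∸-cancelʳ-≡ (lower i) (lower j)
    (trans (sym (toℕ-fromℕ< _)) (trans (cong toℕ eq) (toℕ-fromℕ< _))))

module _ {a} {A : Set a} where

  Unique⇒lookup-injective : {xs : List A} → Unique xs → Injective _≡_ _≡_ (lookup xs)
  Unique⇒lookup-injective (_ ∷ _)   {zero}  {zero}  _  = refl
  Unique⇒lookup-injective (x∉ ∷ _)  {zero}  {suc j} eq = ⊥-elim (All.lookup x∉ (∈-lookup j) eq)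
  Unique⇒lookup-injective (x∉ ∷ _)  {suc i} {zero}  eq = ⊥-elim (All.lookup x∉ (∈-lookup i) (sym eq))
  Unique⇒lookup-injective (_ ∷ xs!) {suc i} {suc j} eq = cong suc (Unique⇒lookup-injective xs! eq)

  Unique⇒injection : ∀ {m} {xs : List A} → Unique xs → m ≤ length xs →
                     Σ (Fin m → A) λ f → Injective _≡_ _≡_ f × (∀ i → f i ∈ xs)
  Unique⇒injection {m} {xs} xs! m≤∣xs∣ =
    lookup xs ∘ embed ,
    (λ eq → inject≤-injective m≤∣xs∣ m≤∣xs∣ _ _ (Unique⇒lookup-injective xs! eq)) ,
    λ i → ∈-lookup (embed i)
    where
    embed : Fin m → Fin (length xs)
    embed i = inject≤ i m≤∣xs∣

module DihedralGroup (n : ℕ) {{_ : NonZero n}} where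
  open Dihedral n

  [m%n+o]%n≡[m+o]%n : ∀ m o → (m % n + o) % n ≡ (m + o) % n
  [m%n+o]%n≡[m+o]%n m o = begin
    (m % n + o) % n          ≡⟨ %-distribˡ-+ (m % n) o n ⟩
    (m % n % n + o % n) % n  ≡⟨ cong (λ x → (x + o % n) % n) (m%n%n≡m%n m n) ⟩
    (m % n + o % n) % n      ≡⟨ %-distribˡ-+ m o n ⟨
    (m + o) % n              ∎
    where open ≡-Reasoning

  [m+o%n]%n≡[m+o]%n : ∀ m o → (m + o % n) % n ≡ (m + o) % n
  [m+o%n]%n≡[m+o]%n m o = begin
    (m + o % n) % n  ≡⟨ cong (_% n) (+-comm m (o % n)) ⟩
    (o % n + m) % n  ≡⟨ [m%n+o]%n≡[m+o]%n o m ⟩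
    (o + m) % n      ≡⟨ cong (_% n) (+-comm o m) ⟩
    (m + o) % n      ∎
    where open ≡-Reasoning

  toℕ-mod : ∀ m → toℕ (m mod n) ≡ m % n
  toℕ-mod m = toℕ-fromℕ< _

  toℕ-addF : ∀ i j → toℕ (addF i j) ≡ (toℕ i + toℕ j) % n
  toℕ-addF i j = toℕ-mod _

  0F : Fin n
  0F = 0 mod n

  toℕ-0F : toℕ 0F ≡ 0
  toℕ-0F = trans (toℕ-mod 0) (m<n⇒m%n≡m (>-nonZero⁻¹ n))

  addF-assoc : ∀ i j k → addF (addF i j) k ≡ addF i (addF j k)
  addF-assoc i j k = toℕ-injective (begin
    toℕ (addF (addF i j) k)                 ≡⟨ toℕ-addF _ k ⟩
    (toℕ (addF i j) + toℕ k) % n            ≡⟨ cong (λ x → (x + toℕ k) % n) (toℕ-addF i j) ⟩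
    ((toℕ i + toℕ j) % n + toℕ k) % n       ≡⟨ [m%n+o]%n≡[m+o]%n _ _ ⟩
    (toℕ i + toℕ j + toℕ k) % n             ≡⟨ cong (_% n) (+-assoc (toℕ i) _ _) ⟩
    (toℕ i + (toℕ j + toℕ k)) % n           ≡⟨ [m+o%n]%n≡[m+o]%n _ _ ⟨
    (toℕ i + (toℕ j + toℕ k) % n) % n       ≡⟨ cong (λ x → (toℕ i + x) % n) (toℕ-addF j k) ⟨
    (toℕ i + toℕ (addF j k)) % n            ≡⟨ toℕ-addF i _ ⟨
    toℕ (addF i (addF j k))                 ∎)
    where open ≡-Reasoning

  addF-comm : ∀ i j → addF i j ≡ addF j i
  addF-comm i j = cong (_mod n) (+-comm (toℕ i) (toℕ j))

  addF-identityˡ : ∀ i → addF 0F i ≡ i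
  addF-identityˡ i = toℕ-injective (begin
    toℕ (addF 0F i)          ≡⟨ toℕ-addF 0F i ⟩
    (toℕ 0F + toℕ i) % n     ≡⟨ cong (λ x → (x + toℕ i) % n) toℕ-0F ⟩
    toℕ i % n                ≡⟨ m<n⇒m%n≡m (toℕ<n i) ⟩
    toℕ i                    ∎)
    where open ≡-Reasoning

  addF-inverseʳ : ∀ i → addF i (negF i) ≡ 0F
  addF-inverseʳ i = toℕ-injective (begin
    toℕ (addF i (negF i))            ≡⟨ toℕ-addF i _ ⟩
    (toℕ i + toℕ (negF i)) % n       ≡⟨ cong (λ x → (toℕ i + x) % n) (toℕ-mod _) ⟩
    (toℕ i + (n ∸ toℕ i) % n) % n    ≡⟨ [m+o%n]%n≡[m+o]%n _ _ ⟩
    (toℕ i + (n ∸ toℕ i)) % n        ≡⟨ cong (_% n) (m+[n∸m]≡n (<⇒≤ (toℕ<n i))) ⟩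
    n % n                            ≡⟨ n%n≡0 n ⟩
    0                                ≡⟨ toℕ-0F ⟨
    toℕ 0F                           ∎)
    where open ≡-Reasoning

  cyclicGroup : AbelianGroup _ _
  cyclicGroup = record
    { Carrier = Fin n
    ; _≈_ = _≡_
    ; _∙_ = addF
    ; ε = 0F
    ; _⁻¹ = negF
    ; isAbelianGroup = record
      { isGroup = record
        { isMonoid = record
          { isSemigroup = record
            { isMagma = record { isEquivalence = isEquivalence ; ∙-cong = cong₂ addF }
            ; assoc = addF-assoc
            }
          ; identity = comm∧idˡ⇒id addF-comm addF-identityˡ
          }
        ; inverse = comm∧invʳ⇒inv addF-comm addF-inverseʳ
        ; ⁻¹-cong = cong negF
        }
      ; comm = addF-comm
      }
    }

  private module ℤₙ where
    open AbelianGroup cyclicGroup public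
    open AbelianGroupProperties cyclicGroup public

  negF-distrib-addF : ∀ i j → negF (addF i j) ≡ addF (negF i) (negF j)
  negF-distrib-addF i j = sym (ℤₙ.⁻¹-∙-comm i j)

  [i-j]-k≡i-[j+k] : ∀ i j k → addF (addF i (negF j)) (negF k) ≡ addF i (negF (addF j k))
  [i-j]-k≡i-[j+k] i j k = begin
    addF (addF i (negF j)) (negF k)  ≡⟨ ℤₙ.assoc i _ _ ⟩
    addF i (addF (negF j) (negF k))  ≡⟨ cong (addF i) (negF-distrib-addF j k) ⟨
    addF i (negF (addF j k))         ∎
    where open ≡-Reasoning

  [i-j]+k≡i-[j-k] : ∀ i j k → addF (addF i (negF j)) k ≡ addF i (negF (addF j (negF k)))
  [i-j]+k≡i-[j-k] i j k = begin
    addF (addF i (negF j)) k                 ≡⟨ ℤₙ.assoc i _ _ ⟩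
    addF i (addF (negF j) k)                 ≡⟨ cong (λ x → addF i (addF (negF j) x)) (ℤₙ.⁻¹-involutive k) ⟨
    addF i (addF (negF j) (negF (negF k)))   ≡⟨ cong (addF i) (negF-distrib-addF j (negF k)) ⟨
    addF i (negF (addF j (negF k)))          ∎
    where open ≡-Reasoning

  ·-assoc : ∀ x y z → (x · y) · z ≡ x · (y · z)
  ·-assoc (false , i) (false , j) (_ , k) = cong (_ ,_) (ℤₙ.assoc i j k)
  ·-assoc (false , i) (true  , j) (_ , k) = cong (_ ,_) (ℤₙ.assoc i j (negF k))
  ·-assoc (true  , i) (false , j) (_ , k) = cong (_ ,_) ([i-j]-k≡i-[j+k] i j k)
  ·-assoc (true  , i) (true  , j) (false , k) = cong (_ ,_) ([i-j]+k≡i-[j-k] i j k)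
  ·-assoc (true  , i) (true  , j) (true  , k) = cong (_ ,_) ([i-j]+k≡i-[j-k] i j k)

  ·-identityˡ : ∀ x → e · x ≡ x
  ·-identityˡ (_ , i) = cong (_ ,_) (ℤₙ.identityˡ i)

  ·-identityʳ : ∀ x → x · e ≡ x
  ·-identityʳ (false , i) = cong (_ ,_) (ℤₙ.identityʳ i)
  ·-identityʳ (true  , i) = cong (_ ,_) (trans (cong (addF i) ℤₙ.ε⁻¹≈ε) (ℤₙ.identityʳ i))

  ·-inverseˡ : ∀ x → inv x · x ≡ e
  ·-inverseˡ (false , i) = cong (_ ,_) (ℤₙ.inverseˡ i)
  ·-inverseˡ (true  , i) = cong (_ ,_) (ℤₙ.inverseʳ i)

  ·-inverseʳ : ∀ x → x · inv x ≡ e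
  ·-inverseʳ (false , i) = cong (_ ,_) (ℤₙ.inverseʳ i)
  ·-inverseʳ (true  , i) = cong (_ ,_) (ℤₙ.inverseʳ i)

  dihedralGroup : Group _ _
  dihedralGroup = record
    { Carrier = D
    ; _≈_ = _≡_
    ; _∙_ = _·_
    ; ε = e
    ; _⁻¹ = inv
    ; isGroup = record
      { isMonoid = record
        { isSemigroup = record
          { isMagma = record { isEquivalence = isEquivalence ; ∙-cong = cong₂ _·_ }
          ; assoc = ·-assoc
          }
        ; identity = ·-identityˡ , ·-identityʳ
        }
      ; inverse = ·-inverseˡ , ·-inverseʳ
      ; ⁻¹-cong = cong inv
      }
    }

  ∈-elements : ∀ x → x ∈ elements
  ∈-elements (false , i) = ∈-++⁺ˡ (∈-map⁺ (false ,_) (∈-allFin i))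
  ∈-elements (true  , i) = ∈-++⁺ʳ (map (false ,_) (allFin n)) (∈-map⁺ (true ,_) (∈-allFin i))

  elements-unique : Unique elements
  elements-unique =
    ++⁺ (map⁺ (cong proj₂) (allFin⁺ n)) (map⁺ (cong proj₂) (allFin⁺ n)) rotation≢reflection
    where
    rotation≢reflection : ∀ {x} → ¬ (x ∈ map (false ,_) (allFin n) × x ∈ map (true ,_) (allFin n))
    rotation≢reflection (x∈rot , x∈ref) with ∈-map⁻ (false ,_) x∈rot | ∈-map⁻ (true ,_) x∈ref
    ... | _ , _ , refl | _ , _ , ()

  _≟_ : (x y : D) → Dec (x ≡ y)
  _≟_ = ≡-dec _≟ᴮ_ _≟ᶠ_

module DihedralCayley (n : ℕ) {{_ : NonZero n}} (S : Dihedral.Subset n) where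
  open Dihedral n
  open Cayley S
  open DihedralGroup n
  open GroupProperties dihedralGroup
    using (//-rightDividesˡ; //-rightDividesʳ; ⁻¹-anti-homo-//; identityˡ-unique; ∙-cancelʳ)

  Inverse-closed : Set
  Inverse-closed = ∀ g → S (inv g) ≡ S g

  adj-sym : Inverse-closed → ∀ {u w} → Adj u w → Adj w u
  adj-sym S⁻¹≡S {u} {w} u∼w = trans (cong S (sym (⁻¹-anti-homo-// u w))) (trans (S⁻¹≡S _) u∼w)

  translate-adj : ∀ {s} w → S s ≡ true → Adj (s · w) w
  translate-adj {s} w s∈S = trans (cong S (//-rightDividesʳ w s)) s∈S

  walk-prod : ∀ {ws} → All (λ s → S s ≡ true) ws → ∀ y → Walk (prod ws · y) y (length ws)
  walk-prod [] y = subst (λ x → Walk x y 0) (sym (·-identityˡ y)) here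
  walk-prod {s ∷ ws} (s∈S ∷ ws⊆S) y = subst (λ x → Walk x y _) (sym (·-assoc s (prod ws) y))
    (step (translate-adj (prod ws · y) s∈S) (walk-prod ws⊆S y))

  walk-connected : Generates S → ∀ x y → ∃ (Walk x y)
  walk-connected gen x y =
    let ws , ws⊆S , prod≡ = gen (x · inv y)
    in  length ws , subst (λ z → Walk z y (length ws))
                          (trans (cong (_· y) prod≡) (//-rightDividesˡ y x)) (walk-prod ws⊆S y)

  walk0⇒≡ : ∀ {x y} → Walk x y 0 → x ≡ y
  walk0⇒≡ here = refl

  walk? : ∀ k x y → Dec (Walk x y k)
  walk? zero    x y = map′ (λ { refl → here }) walk0⇒≡ (x ≟ y)
  walk? (suc k) x y = map′ from-any to-any (any? (λ z → (S (x · inv z) ≟ᴮ true) ×-dec walk? k z y) elements)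
    where
    from-any : Any (λ z → Adj x z × Walk z y k) elements → Walk x y (suc k)
    from-any p = let _ , x∼z , z⇝y = satisfied p in step x∼z z⇝y

    to-any : Walk x y (suc k) → Any (λ z → Adj x z × Walk z y k) elements
    to-any (step {y = z} x∼z z⇝y) = lose (∈-elements z) (x∼z , z⇝y)

  dist : Generates S → ∀ x y → ∃ (Dist x y)
  dist gen x y = least-witness (λ k → walk? k x y) (proj₂ (walk-connected gen x y))

  Dist-≤-walk : ∀ {x y k m} → Dist x y k → Walk x y m → k ≤ m
  Dist-≤-walk (_ , shortest) x⇝y = ≮⇒≥ (λ m<k → shortest _ m<k x⇝y)

  Dist-adj-≤ : ∀ {u v w k l} → Adj u v → Dist u w k → Dist v w l → k ≤ suc l
  Dist-adj-≤ u∼v du dv = Dist-≤-walk du (step u∼v (proj₁ dv))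

  Dist-translate : S e ≡ false → ∀ {s} w → S s ≡ true → Dist (s · w) w 1
  Dist-translate e∉S {s} w s∈S = step (translate-adj w s∈S) here , no-shorter
    where
    no-shorter : ∀ j → j < 1 → ¬ Walk (s · w) w j
    no-shorter zero _ sw⇝w with trans (cong S (sym (identityˡ-unique s w (walk0⇒≡ sw⇝w)))) s∈S
    ... | e∈S with trans (sym e∉S) e∈S
    ...   | ()
    no-shorter (suc _) (s≤s ())

  distinct-generators : ∀ {m} → m ≤ card S →
                        Σ (Fin m → D) λ f → Injective _≡_ _≡_ f × (∀ i → S (f i) ≡ true)
  distinct-generators m≤∣S∣ =
    let f , f-injective , f∈S = Unique⇒injection (filter⁺ (T? ∘ S) elements-unique) m≤∣S∣
    in  f , f-injective , λ i → Equivalence.to T-≡ (All.lookup (all-filter (T? ∘ S) elements) (f∈S i))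

  Resolving⇒translate-injective : S e ≡ false → ∀ {w ws s s′} → Resolving (w ∷ ws) →
    S s ≡ true → S s′ ≡ true →
    All (λ v → ∃ λ k → Dist (s · w) v k × Dist (s′ · w) v k) ws → s ≡ s′
  Resolving⇒translate-injective e∉S {w} {s = s} {s′} resolving s∈S s′∈S same-dists =
    ∙-cancelʳ w s s′ (resolving _ _
      ((1 , Dist-translate e∉S w s∈S , Dist-translate e∉S w s′∈S) ∷ same-dists))

  translates-collide : Generates S → Inverse-closed → ∀ {m} → 3 < m →
    (f : Fin m → D) → (∀ i → S (f i) ≡ true) → ∀ w₁ w₂ →
    ∃₂ λ i j → i ≢ j × ∃ λ k → Dist (f i · w₁) w₂ k × Dist (f j · w₁) w₂ k
  translates-collide gen S⁻¹≡S {m} 3<m f f∈S w₁ w₂ =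
    let i , j , i≢j , kᵢ≡kⱼ = within-one-pigeonhole 3<m k lower upper
    in  i , j , i≢j , k i , dist-proof i , subst (Dist _ w₂) (sym kᵢ≡kⱼ) (dist-proof j)
    where
    d : ℕ
    d = proj₁ (dist gen w₁ w₂)

    base : Dist w₁ w₂ d
    base = proj₂ (dist gen w₁ w₂)

    k : Fin m → ℕ
    k i = proj₁ (dist gen (f i · w₁) w₂)

    dist-proof : ∀ i → Dist (f i · w₁) w₂ (k i)
    dist-proof i = proj₂ (dist gen (f i · w₁) w₂)

    lower : ∀ i → d ≤ suc (k i)
    lower i = Dist-adj-≤ (adj-sym S⁻¹≡S (translate-adj w₁ (f∈S i))) base (dist-proof i)

    upper : ∀ i → k i ≤ suc d
    upper i = Dist-adj-≤ (translate-adj w₁ (f∈S i)) (dist-proof i) base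

  ¬Resolving-[] : ¬ Resolving []
  ¬Resolving-[] resolving with resolving e b []
  ... | ()

  ¬Resolving-singleton : S e ≡ false → 2 ≤ card S → ∀ w → ¬ Resolving (w ∷ [])
  ¬Resolving-singleton e∉S 2≤∣S∣ w resolving =
    let f , f-injective , f∈S = distinct-generators 2≤∣S∣
    in  0≢1+n (f-injective (Resolving⇒translate-injective e∉S resolving (f∈S zero) (f∈S (suc zero)) []))

  ¬Resolving-pair : S e ≡ false → Inverse-closed → Generates S → 4 ≤ card S →
                    ∀ w₁ w₂ → ¬ Resolving (w₁ ∷ w₂ ∷ [])
  ¬Resolving-pair e∉S S⁻¹≡S gen 4≤∣S∣ w₁ w₂ resolving =
    let f , f-injective , f∈S = distinct-generators 4≤∣S∣
        i , j , i≢j , same-dist = translates-collide gen S⁻¹≡S ≤-refl f f∈S w₁ w₂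
    in  i≢j (f-injective (Resolving⇒translate-injective e∉S resolving (f∈S i) (f∈S j) (same-dist ∷ [])))

mainTheorem4 : (n : ℕ) → {{nz : NonZero n}} → 2 ≤ n →
    let open Dihedral n in
    (S : Subset) →
    S e ≡ false →
    (∀ g → S (inv g) ≡ S g) →
    Generates S →
    4 ≤ card S →
    Cayley.MetricDimAtLeast S 3
mainTheorem4 n _ S e∉S S⁻¹≡S gen 4≤∣S∣ = λ where
    []              _ resolving →
      ⊥-elim (¬Resolving-[] resolving)
    (w ∷ [])        _ resolving →
      ⊥-elim (¬Resolving-singleton e∉S (≤-trans (s≤s (s≤s z≤n)) 4≤∣S∣) w resolving)
    (w₁ ∷ w₂ ∷ [])  _ resolving →
      ⊥-elim (¬Resolving-pair e∉S S⁻¹≡S gen 4≤∣S∣ w₁ w₂ resolving)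
    (_ ∷ _ ∷ _ ∷ _) _ _         → s≤s (s≤s (s≤s z≤n))
  where open DihedralCayley n S
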